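{- Typechecking of $\beta$-normal terms in System $\mathsf{F}_{<:}^{\top}$ is decidable: there is an algorithm which, given a $\beta$-normal $\mathsf{F}_{<:}^{\top}$-term $\Theta \vdash^\top t$ and an $\mathsf{F}_{<:}^{\top}$-type $\Theta \vdash^\top T$, always terminates and decides whether the typing judgment $\Theta \vdash^\top t : T$ is derivable in System $\mathsf{F}_{<:}^{\top}$.
   Context: Types of System $\mathsf{F}_{<:}^{\top}$: $T ::= \top \mid X \mid T \to T \mid \forall^\top(X<:T).T$ ($X$ ranges over type variables; the quantifier binds $X$ in the body; types are identified up to $\alpha$-conversion). Raw terms: $t ::= \mathsf{top} \mid x \mid \lambda(x:T).t \mid \Lambda(X<:T).t \mid t\,t \mid t\{T\}$, identified up to $\alpha$-conversion. A context $\Theta$ is a finite sequence of assumptions $X<:T$ and $x:T$. Well-formedness $\Theta \vdash T$: the empty context gives $\vdash \top$; if $\Theta\vdash S$, $\Theta\vdash T$ and $X\notin\mathrm{dom}(\Theta)$ then $\Theta,X<:S\vdash T$; if $\Theta\vdash S$, $\Theta \vdash T$, $x\notin\mathrm{dom}(\Theta)$ then $\Theta,x:S\vdash T$; if $\Theta,X<:T\vdash\top$ then $\Theta,X<:T\vdash X$; $\Theta\vdash S,\Theta\vdash T$ give $\Theta\vdash S\to T$; $\Theta,X<:S\vdash T$ gives $\Theta\vdash\forall^\top(X<:S).T$. Subtyping $\Theta\vdash^\top S<:T$ is generated by: (Var) $\Theta,X<:T,\Theta'\vdash X<:T$ (context well-formed); (Top) $\Theta\vdash T<:\top$; (Refl)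 $\Theta\vdash T<:T$; (Trans); ($\to$) from $\Theta\vdash S'<:S$ and $\Theta\vdash T<:T'$ infer $\Theta\vdash S\to T<:S'\to T'$; ($\forall$-Top) from $\Theta\vdash T_0<:S_0$ and $\Theta,X<:\top\vdash S_1<:T_1$ infer $\Theta\vdash\forall^\top(X<:S_0).S_1<:\forall^\top(X<:T_0).T_1$. Typing $\Theta\vdash^\top t:T$ is generated by: $\Theta\vdash\mathsf{top}:\top$ (for well-formed $\Theta$); $\Theta,x:T,\Theta'\vdash x:T$ (well-formed context); subsumption (from $t:T$ and $T<:T'$ infer $t:T'$); from $\Theta,x:S\vdash t:T$ infer $\Theta\vdash\lambda(x:S).t:S\to T$; from $\Theta\vdash t:S\to T$ and $\Theta\vdash s:S$ infer $\Theta\vdash t\,s:T$; from $\Theta,X<:S\vdash t:T$ infer $\Theta\vdash\Lambda(X<:S).t:\forall^\top(X<:S).T$; from $\Theta\vdash t:\forall^\top(X<:S).T$ and $\Theta\vdash S'<:S$ infer $\Theta\vdash t\{S'\}:T[S'/X]$ (capture-avoiding substitution). An $\mathsf{F}_{<:}^{\top}$-term $\Theta\vdash^\top t$ is a well-formed context $\Theta$ together with a raw term $t$ all of whose type annotations (in $\Theta$ and in $t$) are $\mathsf{F}_{<:}^{\top}$-types well-formed in the appropriate context. A term is $\beta$-normal if it has no subterm of the form $(\lambda(x:S).t)\,s$ or $(\Lambda(X<:S).t)\{R\}$. -}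

module Defs where

open import Data.Nat using (ℕ; zero; suc; pred; _<ᵇ_; _≡ᵇ_)
open import Data.Bool using (if_then_else_)

-- Type variables and term variables live in separate index spaces:
-- a type variable index n refers to the n-th type-variable binding
-- (X <: T) counted from the right end of the context; a term variable
-- index n refers to the n-th term-variable binding (x : T) counted
-- from the right.

infixr 30 _⇒_

-- Types  T ::= ⊤ | X | T → T | ∀⊤(X<:T).T   (body binds index 0)
data Ty : Set where
  top  : Ty
  var  : ℕ → Ty
  _⇒_  : Ty → Ty → Ty
  all  : Ty → Ty → Ty

data Tm : Set where
  top  : Tm
  var  : ℕ → Tm
  lam  : Ty → Tm → Tm
  tlam : Ty → Tm → Tm
  app  : Tm → Tm → Tm
  tapp : Tm → Ty → Tm

-- Contexts: snoc lists of assumptions X <: T and x : T.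
-- The annotation of an entry is scoped over the type variables to its left.
infixl 20 _,<:_ _,∶_
data Ctx : Set where
  ∅     : Ctx
  _,<:_ : Ctx → Ty → Ctx
  _,∶_  : Ctx → Ty → Ctx

shift : ℕ → Ty → Ty
shift c top       = top
shift c (var n)   = if n <ᵇ c then var n else var (suc n)
shift c (S ⇒ T)   = shift c S ⇒ shift c T
shift c (all S T) = all (shift c S) (shift (suc c) T)

wk : Ty → Ty
wk = shift 0

wkN : ℕ → Ty → Ty
wkN zero    T = T
wkN (suc k) T = wk (wkN k T)

-- capture-avoiding substitution of S for type variable j in T
-- (variables above j are decremented since the binder disappears)
substAt : ℕ → Ty → Ty → Ty
substAt j S top       = top
substAt j S (var n)   =
  if n <ᵇ j then var n else (if n ≡ᵇ j then wkN j S else var (pred n))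
substAt j S (A ⇒ B)   = substAt j S A ⇒ substAt j S B
substAt j S (all A B) = all (substAt j S A) (substAt (suc j) S B)

_[_] : Ty → Ty → Ty
T [ S ] = substAt 0 S T

-- Looking up a type variable: TyVarIn Θ n B  means Θ = Θ₁ , X <: B₀ , Θ₂
-- with X the n-th type variable from the right and B = B₀ weakened to Θ.
data TyVarIn : Ctx → ℕ → Ty → Set where
  here   : ∀ {Θ T} → TyVarIn (Θ ,<: T) zero (wk T)
  thereT : ∀ {Θ n T S} → TyVarIn Θ n T → TyVarIn (Θ ,<: S) (suc n) (wk T)
  thereX : ∀ {Θ n T S} → TyVarIn Θ n T → TyVarIn (Θ ,∶ S) n T

-- Looking up a term variable: TmVarIn Θ n T  means Θ = Θ₁ , x : T₀ , Θ₂
-- with x the n-th term variable from the right and T = T₀ weakened to Θ.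
data TmVarIn : Ctx → ℕ → Ty → Set where
  here   : ∀ {Θ T} → TmVarIn (Θ ,∶ T) zero T
  thereX : ∀ {Θ n T S} → TmVarIn Θ n T → TmVarIn (Θ ,∶ S) (suc n) T
  thereT : ∀ {Θ n T S} → TmVarIn Θ n T → TmVarIn (Θ ,<: S) n (wk T)

-- Well-formedness  Θ ⊢ T  (exactly the rules of the paper;
-- in particular Θ ⊢ ⊤ expresses that Θ is a well-formed context)
infix 4 _⊢_
data _⊢_ : Ctx → Ty → Set where
  wf-empty : ∅ ⊢ top
  wf-wkT   : ∀ {Θ S T} → Θ ⊢ S → Θ ⊢ T → (Θ ,<: S) ⊢ wk T
  wf-wkX   : ∀ {Θ S T} → Θ ⊢ S → Θ ⊢ T → (Θ ,∶ S) ⊢ T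
  wf-var   : ∀ {Θ T} → (Θ ,<: T) ⊢ top → (Θ ,<: T) ⊢ var zero
  wf-arr   : ∀ {Θ S T} → Θ ⊢ S → Θ ⊢ T → Θ ⊢ S ⇒ T
  wf-all   : ∀ {Θ S T} → (Θ ,<: S) ⊢ T → Θ ⊢ all S T

infix 4 _⊢_<:_
data _⊢_<:_ : Ctx → Ty → Ty → Set where
  s-var   : ∀ {Θ n T} → Θ ⊢ top → TyVarIn Θ n T → Θ ⊢ var n <: T
  s-top   : ∀ {Θ T} → Θ ⊢ T <: top
  s-refl  : ∀ {Θ T} → Θ ⊢ T <: T
  s-trans : ∀ {Θ S T U} → Θ ⊢ S <: T → Θ ⊢ T <: U → Θ ⊢ S <: U
  s-arr   : ∀ {Θ S S' T T'} → Θ ⊢ S' <: S → Θ ⊢ T <: T' →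
            Θ ⊢ S ⇒ T <: S' ⇒ T'
  s-all   : ∀ {Θ S₀ S₁ T₀ T₁} → Θ ⊢ T₀ <: S₀ → (Θ ,<: top) ⊢ S₁ <: T₁ →
            Θ ⊢ all S₀ S₁ <: all T₀ T₁

infix 4 _⊢_∶_
data _⊢_∶_ : Ctx → Tm → Ty → Set where
  t-top  : ∀ {Θ} → Θ ⊢ top → Θ ⊢ top ∶ top
  t-var  : ∀ {Θ n T} → Θ ⊢ top → TmVarIn Θ n T → Θ ⊢ var n ∶ T
  t-sub  : ∀ {Θ t T T'} → Θ ⊢ t ∶ T → Θ ⊢ T <: T' → Θ ⊢ t ∶ T'
  t-lam  : ∀ {Θ S t T} → (Θ ,∶ S) ⊢ t ∶ T → Θ ⊢ lam S t ∶ S ⇒ T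
  t-app  : ∀ {Θ t s S T} → Θ ⊢ t ∶ S ⇒ T → Θ ⊢ s ∶ S → Θ ⊢ app t s ∶ T
  t-tlam : ∀ {Θ S t T} → (Θ ,<: S) ⊢ t ∶ T → Θ ⊢ tlam S t ∶ all S T
  t-tapp : ∀ {Θ t S T S'} → Θ ⊢ t ∶ all S T → Θ ⊢ S' <: S →
           Θ ⊢ tapp t S' ∶ T [ S' ]

data AnnWf : Ctx → Tm → Set where
  a-top  : ∀ {Θ} → AnnWf Θ top
  a-var  : ∀ {Θ n} → AnnWf Θ (var n)
  a-lam  : ∀ {Θ S t} → Θ ⊢ S → AnnWf (Θ ,∶ S) t → AnnWf Θ (lam S t)
  a-tlam : ∀ {Θ S t} → Θ ⊢ S → AnnWf (Θ ,<: S) t → AnnWf Θ (tlam S t)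
  a-app  : ∀ {Θ t s} → AnnWf Θ t → AnnWf Θ s → AnnWf Θ (app t s)
  a-tapp : ∀ {Θ t S} → AnnWf Θ t → Θ ⊢ S → AnnWf Θ (tapp t S)

-- An F<:^⊤-term Θ ⊢⊤ t : well-formed context with well-formed annotations
-- (context annotations are well-formed because Θ ⊢ ⊤ is derivable)
record WfTerm (Θ : Ctx) (t : Tm) : Set where
  constructor wfTerm
  field
    ctxWf : Θ ⊢ top
    annWf : AnnWf Θ t

data BetaNormal : Tm → Set
data NotLam : Tm → Set where
  nl-top  : NotLam top
  nl-var  : ∀ {n} → NotLam (var n)
  nl-tlam : ∀ {S t} → NotLam (tlam S t)
  nl-app  : ∀ {t s} → NotLam (app t s)
  nl-tapp : ∀ {t S} → NotLam (tapp t S)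
data NotTLam : Tm → Set where
  nt-top  : NotTLam top
  nt-var  : ∀ {n} → NotTLam (var n)
  nt-lam  : ∀ {S t} → NotTLam (lam S t)
  nt-app  : ∀ {t s} → NotTLam (app t s)
  nt-tapp : ∀ {t S} → NotTLam (tapp t S)
data BetaNormal where
  bn-top  : BetaNormal top
  bn-var  : ∀ {n} → BetaNormal (var n)
  bn-lam  : ∀ {S t} → BetaNormal t → BetaNormal (lam S t)
  bn-tlam : ∀ {S t} → BetaNormal t → BetaNormal (tlam S t)
  bn-app  : ∀ {t s} → NotLam t → BetaNormal t → BetaNormal s →
            BetaNormal (app t s)
  bn-tapp : ∀ {t S} → NotTLam t → BetaNormal t → BetaNormal (tapp t S)

module Submission where

-- Subtyping is decided through the syntax-directed system ⊢ₐ, in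
-- which a variable is only related to a non-variable supertype via its bound; transitivity is
-- admissible there because the ∀-rule compares both bodies under the same bound ⊤, and proof
-- search terminates because every type variable is given a weight exceeding that of its bound.
-- Neutral terms have minimal types, computed by exposing the minimal type of the head. A
-- Λ-abstraction has none in general, since its body is typed under its bound but ∀-bodies are
-- compared under ⊤, so abstractions are checked against the expected type instead; in a β-normal
-- term every head is neutral, so abstractions only ever occur in checking positions.

open import Data.Bool using (if_then_else_)
open import Data.Bool.Properties using (if-float)
open import Data.Nat using (ℕ; zero; suc; _+_; _≤_; _<_; z≤n; s≤s; _<ᵇ_; _≡ᵇ_)
open import Data.Nat.Properties
  using (≤-trans; ≤-pred; n<1+n; <-≤-trans; ≤-reflexive; n≤1+n; m≤m+n; m≤n+m; +-comm; +-mono-≤; +-monoʳ-≤; +-monoˡ-<; _≟_)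
open import Data.Product using (Σ; ∃; _×_; _,_)
open import Data.Sum using (_⊎_; inj₁; inj₂)
open import Function using (case_of_)
open import Relation.Nullary using (Dec; yes; no; ¬_)
open import Relation.Binary.PropositionalEquality
  using (_≡_; refl; sym; trans; cong; cong₂; subst; module ≡-Reasoning)

open import Defs

variable
  Γ Γ' : Ctx
  A B B' C M N N' S S' T T' U : Ty
  k n : ℕ
  f s t u : Tm

shiftℕ : ℕ → ℕ → ℕ
shiftℕ zero    n       = suc n
shiftℕ (suc c) zero    = zero
shiftℕ (suc c) (suc n) = suc (shiftℕ c n)

shift-var : ∀ c n → shift c (var n) ≡ var (shiftℕ c n)
shift-var zero    n       = refl
shift-var (suc c) zero    = refl
shift-var (suc c) (suc n) = trans (sym (if-float wk (n <ᵇ c))) (cong wk (shift-var c n))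

substVar : ℕ → Ty → ℕ → Ty
substVar zero    S zero    = S
substVar zero    S (suc n) = var n
substVar (suc j) S zero    = var zero
substVar (suc j) S (suc n) = wk (substVar j S n)

substAt-var : ∀ j S n → substAt j S (var n) ≡ substVar j S n
substAt-var zero          S zero          = refl
substAt-var zero          S (suc n)       = refl
substAt-var (suc j)       S zero          = refl
substAt-var (suc zero)    S (suc zero)    = refl
substAt-var (suc (suc j)) S (suc zero)    = refl
substAt-var (suc j)       S (suc (suc n)) =
  trans (cong (λ e → if suc n <ᵇ j then var (suc (suc n)) else e)
              (sym (if-float wk (suc n ≡ᵇ j))))
        (trans (sym (if-float wk (suc n <ᵇ j))) (cong wk (substAt-var j S (suc n))))

shiftℕ-comm : ∀ {c d} n → c ≤ d → shiftℕ c (shiftℕ d n) ≡ shiftℕ (suc d) (shiftℕ c n)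
shiftℕ-comm {zero}              n       _         = refl
shiftℕ-comm {suc c} {suc d} zero    _         = refl
shiftℕ-comm {suc c} {suc d} (suc n) (s≤s c≤d) = cong suc (shiftℕ-comm n c≤d)

shift-comm : ∀ c d T → c ≤ d → shift c (shift d T) ≡ shift (suc d) (shift c T)
shift-comm c d top       _   = refl
shift-comm c d (var n)   c≤d = begin
  shift c (shift d (var n))               ≡⟨ cong (shift c) (shift-var d n) ⟩
  shift c (var (shiftℕ d n))              ≡⟨ shift-var c _ ⟩
  var (shiftℕ c (shiftℕ d n))             ≡⟨ cong var (shiftℕ-comm n c≤d) ⟩
  var (shiftℕ (suc d) (shiftℕ c n))       ≡⟨ shift-var (suc d) _ ⟨
  shift (suc d) (var (shiftℕ c n))        ≡⟨ cong (shift (suc d)) (shift-var c n) ⟨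
  shift (suc d) (shift c (var n))         ∎
  where open ≡-Reasoning
shift-comm c d (A ⇒ B)   c≤d = cong₂ _⇒_ (shift-comm c d A c≤d) (shift-comm c d B c≤d)
shift-comm c d (all A B) c≤d = cong₂ all (shift-comm c d A c≤d) (shift-comm (suc c) (suc d) B (s≤s c≤d))

substVar-shiftℕ : ∀ c S n → substVar c S (shiftℕ c n) ≡ var n
substVar-shiftℕ zero    S n       = refl
substVar-shiftℕ (suc c) S zero    = refl
substVar-shiftℕ (suc c) S (suc n) = cong wk (substVar-shiftℕ c S n)

substAt-shift : ∀ c S T → substAt c S (shift c T) ≡ T
substAt-shift c S top       = refl
substAt-shift c S (var n)   = begin
  substAt c S (shift c (var n))   ≡⟨ cong (substAt c S) (shift-var c n) ⟩
  substAt c S (var (shiftℕ c n))  ≡⟨ substAt-var c S _ ⟩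
  substVar c S (shiftℕ c n)       ≡⟨ substVar-shiftℕ c S n ⟩
  var n                           ∎
  where open ≡-Reasoning
substAt-shift c S (A ⇒ B)   = cong₂ _⇒_ (substAt-shift c S A) (substAt-shift c S B)
substAt-shift c S (all A B) = cong₂ all (substAt-shift c S A) (substAt-shift (suc c) S B)

substVar-shiftℕ-comm : ∀ {c j} S n → c ≤ j → substVar (suc j) S (shiftℕ c n) ≡ shift c (substVar j S n)
substVar-shiftℕ-comm {zero}          S n       _         = refl
substVar-shiftℕ-comm {suc c} {suc j} S zero    _         = refl
substVar-shiftℕ-comm {suc c} {suc j} S (suc n) (s≤s c≤j) =
  trans (cong wk (substVar-shiftℕ-comm S n c≤j)) (shift-comm 0 c (substVar j S n) z≤n)

substAt-shift-comm : ∀ c j S T → c ≤ j → substAt (suc j) S (shift c T) ≡ shift c (substAt j S T)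
substAt-shift-comm c j S top       _   = refl
substAt-shift-comm c j S (var n)   c≤j = begin
  substAt (suc j) S (shift c (var n))    ≡⟨ cong (substAt (suc j) S) (shift-var c n) ⟩
  substAt (suc j) S (var (shiftℕ c n))   ≡⟨ substAt-var (suc j) S (shiftℕ c n) ⟩
  substVar (suc j) S (shiftℕ c n)        ≡⟨ substVar-shiftℕ-comm S n c≤j ⟩
  shift c (substVar j S n)               ≡⟨ cong (shift c) (substAt-var j S n) ⟨
  shift c (substAt j S (var n))          ∎
  where open ≡-Reasoning
substAt-shift-comm c j S (A ⇒ B)   c≤j =
  cong₂ _⇒_ (substAt-shift-comm c j S A c≤j) (substAt-shift-comm c j S B c≤j)
substAt-shift-comm c j S (all A B) c≤j =
  cong₂ all (substAt-shift-comm c j S A c≤j) (substAt-shift-comm (suc c) (suc j) S B (s≤s c≤j))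

TyVarIn-unique : TyVarIn Γ n B → TyVarIn Γ n B' → B ≡ B'
TyVarIn-unique here       here       = refl
TyVarIn-unique (thereT p) (thereT q) = cong wk (TyVarIn-unique p q)
TyVarIn-unique (thereX p) (thereX q) = TyVarIn-unique p q

TmVarIn-unique : TmVarIn Γ n T → TmVarIn Γ n T' → T ≡ T'
TmVarIn-unique here       here       = refl
TmVarIn-unique (thereX p) (thereX q) = TmVarIn-unique p q
TmVarIn-unique (thereT p) (thereT q) = cong wk (TmVarIn-unique p q)

tyVar? : ∀ Γ n → Dec (∃ (TyVarIn Γ n))
tyVar? ∅         n       = no λ ()
tyVar? (Γ ,∶ S)  n       with tyVar? Γ n
... | yes (B , p) = yes (B , thereX p)
... | no ¬p       = no λ { (B , thereX p) → ¬p (B , p) }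
tyVar? (Γ ,<: S) zero    = yes (wk S , here)
tyVar? (Γ ,<: S) (suc n) with tyVar? Γ n
... | yes (B , p) = yes (wk B , thereT p)
... | no ¬p       = no λ { (_ , thereT p) → ¬p (_ , p) }

tmVar? : ∀ Γ n → Dec (∃ (TmVarIn Γ n))
tmVar? ∅         n       = no λ ()
tmVar? (Γ ,<: S) n       with tmVar? Γ n
... | yes (T , p) = yes (wk T , thereT p)
... | no ¬p       = no λ { (_ , thereT p) → ¬p (_ , p) }
tmVar? (Γ ,∶ S)  zero    = yes (S , here)
tmVar? (Γ ,∶ S)  (suc n) with tmVar? Γ n
... | yes (T , p) = yes (T , thereX p)
... | no ¬p       = no λ { (T , thereX p) → ¬p (T , p) }

extend : ℕ → (ℕ → ℕ) → ℕ → ℕ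
extend x ρ zero    = x
extend x ρ (suc n) = ρ n

-- The variable bound by a ∀ is weighed like a ⊤-bounded one, which is how
-- the subtyping rule for ∀ treats it.
weight : (ℕ → ℕ) → Ty → ℕ
weight ρ top       = 1
weight ρ (var n)   = ρ n
weight ρ (S ⇒ T)   = suc (weight ρ S + weight ρ T)
weight ρ (all S T) = suc (weight ρ S + weight (extend 2 ρ) T)

weight-shift : ∀ c T {ρ ρ'} → (∀ n → ρ' (shiftℕ c n) ≡ ρ n) → weight ρ' (shift c T) ≡ weight ρ T
weight-shift c top       ρ'≗ρ = refl
weight-shift c (var n)   ρ'≗ρ = trans (cong (weight _) (shift-var c n)) (ρ'≗ρ n)
weight-shift c (S ⇒ T)   ρ'≗ρ = cong suc (cong₂ _+_ (weight-shift c S ρ'≗ρ) (weight-shift c T ρ'≗ρ))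
weight-shift c (all S T) ρ'≗ρ =
  cong suc (cong₂ _+_ (weight-shift c S ρ'≗ρ) (weight-shift (suc c) T extended))
  where
  extended : ∀ n → extend 2 _ (shiftℕ (suc c) n) ≡ extend 2 _ n
  extended zero    = refl
  extended (suc n) = ρ'≗ρ n

weight-wk : ∀ x ρ T → weight (extend x ρ) (wk T) ≡ weight ρ T
weight-wk x ρ T = weight-shift 0 T λ _ → refl

varWeights : Ctx → ℕ → ℕ
varWeights ∅         = λ _ → 1
varWeights (Γ ,∶ S)  = varWeights Γ
varWeights (Γ ,<: B) = extend (suc (weight (varWeights Γ) B)) (varWeights Γ)

size : Ctx → Ty → ℕ
size Γ = weight (varWeights Γ)

bound-lighter : TyVarIn Γ n B → size Γ B < varWeights Γ n
bound-lighter {Γ ,<: T} here =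
  subst (_< suc (size Γ T)) (sym (weight-wk _ (varWeights Γ) T)) (n<1+n (size Γ T))
bound-lighter {Γ ,<: S} (thereT {T = T} p) =
  subst (_< varWeights Γ _) (sym (weight-wk _ (varWeights Γ) T)) (bound-lighter p)
bound-lighter (thereX p) = bound-lighter p

infix 4 _⊢ₐ_<:_
data _⊢ₐ_<:_ : Ctx → Ty → Ty → Set where
  sa-top     : Γ ⊢ₐ S <: top
  sa-refl    : Γ ⊢ₐ var n <: var n
  sa-promote : TyVarIn Γ n B → Γ ⊢ₐ B <: U → Γ ⊢ₐ var n <: U
  sa-arr     : Γ ⊢ₐ S' <: S → Γ ⊢ₐ T <: T' → Γ ⊢ₐ S ⇒ T <: S' ⇒ T'
  sa-all     : Γ ⊢ₐ T <: S → (Γ ,<: top) ⊢ₐ S' <: T' → Γ ⊢ₐ all S S' <: all T T'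

<:ₐ-refl : ∀ T → Γ ⊢ₐ T <: T
<:ₐ-refl top       = sa-top
<:ₐ-refl (var n)   = sa-refl
<:ₐ-refl (S ⇒ T)   = sa-arr (<:ₐ-refl S) (<:ₐ-refl T)
<:ₐ-refl (all S T) = sa-all (<:ₐ-refl S) (<:ₐ-refl T)

<:ₐ-trans : Γ ⊢ₐ S <: T → Γ ⊢ₐ T <: U → Γ ⊢ₐ S <: U
<:ₐ-trans sa-top              sa-top         = sa-top
<:ₐ-trans sa-refl             T<:U           = T<:U
<:ₐ-trans (sa-promote p S<:T) T<:U           = sa-promote p (<:ₐ-trans S<:T T<:U)
<:ₐ-trans (sa-arr _ _)        sa-top         = sa-top
<:ₐ-trans (sa-arr d₁ d₂)      (sa-arr e₁ e₂) = sa-arr (<:ₐ-trans e₁ d₁) (<:ₐ-trans d₂ e₂)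
<:ₐ-trans (sa-all _ _)        sa-top         = sa-top
<:ₐ-trans (sa-all d₁ d₂)      (sa-all e₁ e₂) = sa-all (<:ₐ-trans e₁ d₁) (<:ₐ-trans d₂ e₂)

<:⇒<:ₐ : Γ ⊢ S <: T → Γ ⊢ₐ S <: T
<:⇒<:ₐ (s-var _ p)   = sa-promote p (<:ₐ-refl _)
<:⇒<:ₐ s-top         = sa-top
<:⇒<:ₐ s-refl        = <:ₐ-refl _
<:⇒<:ₐ (s-trans d e) = <:ₐ-trans (<:⇒<:ₐ d) (<:⇒<:ₐ e)
<:⇒<:ₐ (s-arr d e)   = sa-arr (<:⇒<:ₐ d) (<:⇒<:ₐ e)
<:⇒<:ₐ (s-all d e)   = sa-all (<:⇒<:ₐ d) (<:⇒<:ₐ e)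

<:ₐ⇒<: : Γ ⊢ top → Γ ⊢ₐ S <: T → Γ ⊢ S <: T
<:ₐ⇒<: wf sa-top           = s-top
<:ₐ⇒<: wf sa-refl          = s-refl
<:ₐ⇒<: wf (sa-promote p d) = s-trans (s-var wf p) (<:ₐ⇒<: wf d)
<:ₐ⇒<: wf (sa-arr d e)     = s-arr (<:ₐ⇒<: wf d) (<:ₐ⇒<: wf e)
<:ₐ⇒<: wf (sa-all d e)     = s-all (<:ₐ⇒<: wf d) (<:ₐ⇒<: (wf-wkT wf wf) e)

top-<:ₐ : Γ ⊢ₐ top <: U → U ≡ top
top-<:ₐ sa-top = refl

data NarrowedTop : Ctx → Ctx → Set where
  narrow-here  : NarrowedTop (Γ ,<: top) (Γ ,<: S)
  narrow-under : NarrowedTop Γ Γ' → NarrowedTop (Γ ,<: top) (Γ' ,<: top)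

narrow-TyVarIn : NarrowedTop Γ Γ' → TyVarIn Γ n C → C ≡ top ⊎ TyVarIn Γ' n C
narrow-TyVarIn narrow-here      here       = inj₁ refl
narrow-TyVarIn narrow-here      (thereT p) = inj₂ (thereT p)
narrow-TyVarIn (narrow-under _) here       = inj₁ refl
narrow-TyVarIn (narrow-under ν) (thereT p) with narrow-TyVarIn ν p
... | inj₁ refl = inj₁ refl
... | inj₂ q    = inj₂ (thereT q)

<:ₐ-narrow : NarrowedTop Γ Γ' → Γ ⊢ₐ S <: T → Γ' ⊢ₐ S <: T
<:ₐ-narrow ν sa-top           = sa-top
<:ₐ-narrow ν sa-refl          = sa-refl
<:ₐ-narrow ν (sa-promote p d) with narrow-TyVarIn ν p
... | inj₁ refl rewrite top-<:ₐ d = sa-top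
... | inj₂ q    = sa-promote q (<:ₐ-narrow ν d)
<:ₐ-narrow ν (sa-arr d e)     = sa-arr (<:ₐ-narrow ν d) (<:ₐ-narrow ν e)
<:ₐ-narrow ν (sa-all d e)     = sa-all (<:ₐ-narrow ν d) (<:ₐ-narrow (narrow-under ν) e)

data TmVarInserted : Ctx → Ctx → Set where
  insert-here  : TmVarInserted Γ (Γ ,∶ S)
  insert-under : TmVarInserted Γ Γ' → TmVarInserted (Γ ,<: B) (Γ' ,<: B)

insert-TyVarIn : TmVarInserted Γ Γ' → TyVarIn Γ n C → TyVarIn Γ' n C
insert-TyVarIn insert-here      p          = thereX p
insert-TyVarIn (insert-under _) here       = here
insert-TyVarIn (insert-under ι) (thereT p) = thereT (insert-TyVarIn ι p)

<:ₐ-weaken : TmVarInserted Γ Γ' → Γ ⊢ₐ S <: T → Γ' ⊢ₐ S <: T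
<:ₐ-weaken ι sa-top           = sa-top
<:ₐ-weaken ι sa-refl          = sa-refl
<:ₐ-weaken ι (sa-promote p d) = sa-promote (insert-TyVarIn ι p) (<:ₐ-weaken ι d)
<:ₐ-weaken ι (sa-arr d e)     = sa-arr (<:ₐ-weaken ι d) (<:ₐ-weaken ι e)
<:ₐ-weaken ι (sa-all d e)     = sa-all (<:ₐ-weaken ι d) (<:ₐ-weaken (insert-under ι) e)

data DroppedTop : Ctx → ℕ → Ctx → Set where
  drop-here  : DroppedTop (Γ ,<: top) zero Γ
  drop-under : DroppedTop Γ' k Γ → DroppedTop (Γ' ,<: top) (suc k) (Γ ,<: top)

drop-TyVarIn : ∀ R → DroppedTop Γ' k Γ → TyVarIn Γ' n C →
  C ≡ top ⊎ Σ ℕ λ m → TyVarIn Γ m (substAt k R C) × substAt k R (var n) ≡ var m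
drop-TyVarIn R drop-here      here                   = inj₁ refl
drop-TyVarIn R drop-here      (thereT {n = n} {T = T} p) =
  inj₂ (n , subst (TyVarIn _ n) (sym (substAt-shift 0 R T)) p , refl)
drop-TyVarIn R (drop-under _) here                   = inj₁ refl
drop-TyVarIn R (drop-under {k = k} δ) (thereT {n = n} {T = T} p) with drop-TyVarIn R δ p
... | inj₁ refl = inj₁ refl
... | inj₂ (m , q , eq) =
  inj₂ (suc m , subst (TyVarIn _ (suc m)) (sym (substAt-shift-comm 0 k R T z≤n)) (thereT q)
              , trans (substAt-shift-comm 0 k R (var n) z≤n) (cong wk eq))

<:ₐ-subst : ∀ R → DroppedTop Γ' k Γ → Γ' ⊢ₐ S <: T → Γ ⊢ₐ substAt k R S <: substAt k R T
<:ₐ-subst R δ sa-top           = sa-top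
<:ₐ-subst R δ sa-refl          = <:ₐ-refl _
<:ₐ-subst {k = k} R δ (sa-promote {U = U} p d) with drop-TyVarIn R δ p
... | inj₁ refl rewrite top-<:ₐ d = sa-top
... | inj₂ (m , q , eq) =
  subst (λ X → _ ⊢ₐ X <: substAt k R U) (sym eq) (sa-promote q (<:ₐ-subst R δ d))
<:ₐ-subst R δ (sa-arr d e)     = sa-arr (<:ₐ-subst R δ d) (<:ₐ-subst R δ e)
<:ₐ-subst R δ (sa-all d e)     = sa-all (<:ₐ-subst R δ d) (<:ₐ-subst R (drop-under δ) e)

<-suc+suc : ∀ {x} a b → x ≤ a + b → x < suc a + suc b
<-suc+suc a b x≤a+b = s≤s (≤-trans x≤a+b (+-monoʳ-≤ a (n≤1+n b)))

contravariant-< : ∀ a c {b d k} → suc (a + b) + suc (c + d) < suc k → c + a < k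
contravariant-< a c {b} {d} lt = <-≤-trans
  (<-suc+suc (a + b) (c + d) (≤-trans (≤-reflexive (+-comm c a)) (+-mono-≤ (m≤m+n a b) (m≤m+n c d))))
  (≤-pred lt)

covariant-< : ∀ b d {a c k} → suc (a + b) + suc (c + d) < suc k → b + d < k
covariant-< b d {a} {c} lt =
  <-≤-trans (<-suc+suc (a + b) (c + d) (+-mono-≤ (m≤n+m b a) (m≤n+m d c))) (≤-pred lt)

Promotable : Ctx → ℕ → Ty → Set
Promotable Γ n U = Σ Ty λ B → TyVarIn Γ n B × Γ ⊢ₐ B <: U

mutual
  <:ₐ?-fuel : ∀ k Γ S T → size Γ S + size Γ T < k → Dec (Γ ⊢ₐ S <: T)
  <:ₐ?-fuel (suc k) Γ S         top         _  = yes sa-top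
  <:ₐ?-fuel (suc k) Γ top       (var _)     _  = no λ ()
  <:ₐ?-fuel (suc k) Γ top       (_ ⇒ _)     _  = no λ ()
  <:ₐ?-fuel (suc k) Γ top       (all _ _)   _  = no λ ()
  <:ₐ?-fuel (suc k) Γ (var n)   (var m)     lt with n ≟ m
  ... | yes refl = yes sa-refl
  ... | no n≢m   with promotable?-fuel k Γ n (var m) (≤-pred lt)
  ...   | yes (_ , p , d) = yes (sa-promote p d)
  ...   | no ¬π           = no λ { sa-refl → n≢m refl ; (sa-promote p d) → ¬π (_ , p , d) }
  <:ₐ?-fuel (suc k) Γ (var n)   (A ⇒ B)     lt with promotable?-fuel k Γ n (A ⇒ B) (≤-pred lt)
  ... | yes (_ , p , d) = yes (sa-promote p d)
  ... | no ¬π           = no λ { (sa-promote p d) → ¬π (_ , p , d) }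
  <:ₐ?-fuel (suc k) Γ (var n)   (all A B)   lt with promotable?-fuel k Γ n (all A B) (≤-pred lt)
  ... | yes (_ , p , d) = yes (sa-promote p d)
  ... | no ¬π           = no λ { (sa-promote p d) → ¬π (_ , p , d) }
  <:ₐ?-fuel (suc k) Γ (_ ⇒ _)   (var _)     _  = no λ ()
  <:ₐ?-fuel (suc k) Γ (_ ⇒ _)   (all _ _)   _  = no λ ()
  <:ₐ?-fuel (suc k) Γ (S ⇒ T)   (S' ⇒ T')   lt
    with <:ₐ?-fuel k Γ S' S (contravariant-< (size Γ S) (size Γ S') lt)
       | <:ₐ?-fuel k Γ T T' (covariant-< (size Γ T) (size Γ T') lt)
  ... | yes d | yes e = yes (sa-arr d e)
  ... | no ¬d | _     = no λ { (sa-arr d _) → ¬d d }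
  ... | yes _ | no ¬e = no λ { (sa-arr _ e) → ¬e e }
  <:ₐ?-fuel (suc k) Γ (all _ _) (var _)     _  = no λ ()
  <:ₐ?-fuel (suc k) Γ (all _ _) (_ ⇒ _)     _  = no λ ()
  <:ₐ?-fuel (suc k) Γ (all S S') (all T T') lt
    with <:ₐ?-fuel k Γ T S (contravariant-< (size Γ S) (size Γ T) lt)
       | <:ₐ?-fuel k (Γ ,<: top) S' T' (covariant-< (size (Γ ,<: top) S') (size (Γ ,<: top) T') lt)
  ... | yes d | yes e = yes (sa-all d e)
  ... | no ¬d | _     = no λ { (sa-all d _) → ¬d d }
  ... | yes _ | no ¬e = no λ { (sa-all _ e) → ¬e e }

  promotable?-fuel : ∀ k Γ n U → varWeights Γ n + size Γ U ≤ k → Dec (Promotable Γ n U)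
  promotable?-fuel k Γ n U le with tyVar? Γ n
  ... | no ¬p = no λ { (B , p , _) → ¬p (B , p) }
  ... | yes (B , p) with <:ₐ?-fuel k Γ B U (<-≤-trans (+-monoˡ-< (size Γ U) (bound-lighter p)) le)
  ...   | yes d = yes (B , p , d)
  ...   | no ¬d = no λ { (B' , p' , d) → ¬d (subst (λ X → Γ ⊢ₐ X <: U) (TyVarIn-unique p' p) d) }

<:ₐ? : ∀ Γ S T → Dec (Γ ⊢ₐ S <: T)
<:ₐ? Γ S T = <:ₐ?-fuel _ Γ S T (n<1+n (size Γ S + size Γ T))

data Compound : Ty → Set where
  ⇒-compound   : Compound (A ⇒ B)
  all-compound : Compound (all A B)

-- Exposure, as in Pierce's algorithmic typing for F<:.
infix 4 _⊢_⇑_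
data _⊢_⇑_ (Γ : Ctx) : Ty → Ty → Set where
  ⇑-compound : Compound N → Γ ⊢ N ⇑ N
  ⇑-promote  : TyVarIn Γ n C → Γ ⊢ C ⇑ N → Γ ⊢ var n ⇑ N

⇑-target : Γ ⊢ M ⇑ N → Compound N
⇑-target (⇑-compound c)  = c
⇑-target (⇑-promote _ e) = ⇑-target e

⇑-unique : Γ ⊢ M ⇑ N → Γ ⊢ M ⇑ N' → N ≡ N'
⇑-unique (⇑-compound _)  (⇑-compound _)   = refl
⇑-unique (⇑-promote p e) (⇑-promote p' e') =
  ⇑-unique e (subst (λ X → _ ⊢ X ⇑ _) (TyVarIn-unique p' p) e')

⇑⇒<:ₐ : Γ ⊢ M ⇑ N → Γ ⊢ₐ M <: N
⇑⇒<:ₐ (⇑-compound _)  = <:ₐ-refl _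
⇑⇒<:ₐ (⇑-promote p e) = sa-promote p (⇑⇒<:ₐ e)

<:ₐ-compound⇒⇑ : Γ ⊢ₐ M <: U → Compound U → Σ Ty λ N → Γ ⊢ M ⇑ N × Γ ⊢ₐ N <: U
<:ₐ-compound⇒⇑ (sa-promote p d) c with <:ₐ-compound⇒⇑ d c
... | N , e , N<:U = N , ⇑-promote p e , N<:U
<:ₐ-compound⇒⇑ (sa-arr d e)     _ = _ , ⇑-compound ⇒-compound , sa-arr d e
<:ₐ-compound⇒⇑ (sa-all d e)     _ = _ , ⇑-compound all-compound , sa-all d e

⇑-<:ₐ : Γ ⊢ M ⇑ N → Γ ⊢ₐ M <: U → Compound U → Γ ⊢ₐ N <: U
⇑-<:ₐ e M<:U c with <:ₐ-compound⇒⇑ M<:U c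
... | _ , e' , N<:U rewrite ⇑-unique e e' = N<:U

exposure?-fuel : ∀ k Γ M → size Γ M < k → Dec (∃ (Γ ⊢ M ⇑_))
exposure?-fuel (suc k) Γ top       _  = no λ { (_ , ⇑-compound ()) }
exposure?-fuel (suc k) Γ (A ⇒ B)   _  = yes (_ , ⇑-compound ⇒-compound)
exposure?-fuel (suc k) Γ (all A B) _  = yes (_ , ⇑-compound all-compound)
exposure?-fuel (suc k) Γ (var n)   lt with tyVar? Γ n
... | no ¬p = no λ { (_ , ⇑-promote p _) → ¬p (_ , p) }
... | yes (C , p) with exposure?-fuel k Γ C (<-≤-trans (bound-lighter p) (≤-pred lt))
...   | yes (N , e) = yes (N , ⇑-promote p e)
...   | no ¬e       =
  no λ { (N , ⇑-promote p' e) → ¬e (N , subst (λ X → Γ ⊢ X ⇑ N) (TyVarIn-unique p' p) e) }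

exposure? : ∀ Γ M → Dec (∃ (Γ ⊢ M ⇑_))
exposure? Γ M = exposure?-fuel _ Γ M (n<1+n (size Γ M))

subsumeₐ : Γ ⊢ top → Γ ⊢ t ∶ T → Γ ⊢ₐ T <: U → Γ ⊢ t ∶ U
subsumeₐ wf d T<:U = t-sub d (<:ₐ⇒<: wf T<:U)

top-inversion : Γ ⊢ top ∶ U → Γ ⊢ₐ top <: U
top-inversion (t-top _)   = sa-top
top-inversion (t-sub d e) = <:ₐ-trans (top-inversion d) (<:⇒<:ₐ e)

var-inversion : Γ ⊢ var n ∶ U → Σ Ty λ T → TmVarIn Γ n T × Γ ⊢ₐ T <: U
var-inversion (t-var _ p) = _ , p , <:ₐ-refl _
var-inversion (t-sub d e) with var-inversion d
... | T , p , T<:U = T , p , <:ₐ-trans T<:U (<:⇒<:ₐ e)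

lam-inversion : Γ ⊢ lam S u ∶ U → Σ Ty λ T → (Γ ,∶ S) ⊢ u ∶ T × Γ ⊢ₐ S ⇒ T <: U
lam-inversion (t-lam d)   = _ , d , <:ₐ-refl _
lam-inversion (t-sub d e) with lam-inversion d
... | T , du , S⇒T<:U = T , du , <:ₐ-trans S⇒T<:U (<:⇒<:ₐ e)

tlam-inversion : Γ ⊢ tlam S u ∶ U → Σ Ty λ T → (Γ ,<: S) ⊢ u ∶ T × Γ ⊢ₐ all S T <: U
tlam-inversion (t-tlam d)  = _ , d , <:ₐ-refl _
tlam-inversion (t-sub d e) with tlam-inversion d
... | T , du , ∀ST<:U = T , du , <:ₐ-trans ∀ST<:U (<:⇒<:ₐ e)

app-inversion : Γ ⊢ app f s ∶ U →
  Σ Ty λ A → Σ Ty λ B → Γ ⊢ f ∶ A ⇒ B × Γ ⊢ s ∶ A × Γ ⊢ₐ B <: U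
app-inversion (t-app df ds) = _ , _ , df , ds , <:ₐ-refl _
app-inversion (t-sub d e) with app-inversion d
... | A , B , df , ds , B<:U = A , B , df , ds , <:ₐ-trans B<:U (<:⇒<:ₐ e)

tapp-inversion : Γ ⊢ tapp f S ∶ U →
  Σ Ty λ A → Σ Ty λ B → Γ ⊢ f ∶ all A B × Γ ⊢ₐ S <: A × Γ ⊢ₐ B [ S ] <: U
tapp-inversion (t-tapp df S<:A) = _ , _ , df , <:⇒<:ₐ S<:A , <:ₐ-refl _
tapp-inversion (t-sub d e) with tapp-inversion d
... | A , B , df , S<:A , B<:U = A , B , df , S<:A , <:ₐ-trans B<:U (<:⇒<:ₐ e)

Minimal : Ctx → Tm → Ty → Set
Minimal Γ t M = ∀ {U} → Γ ⊢ t ∶ U → Γ ⊢ₐ M <: U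

data Inference (Γ : Ctx) (t : Tm) : Set where
  minimal   : (M : Ty) → Γ ⊢ t ∶ M → Minimal Γ t M → Inference Γ t
  untypable : (∀ {U} → ¬ Γ ⊢ t ∶ U) → Inference Γ t

var-minimal : TmVarIn Γ n T → Minimal Γ (var n) T
var-minimal p d with var-inversion d
... | _ , p' , T'<:U rewrite TmVarIn-unique p p' = T'<:U

app-exposure : Minimal Γ f M → Γ ⊢ app f s ∶ U → ∃ (Γ ⊢ M ⇑_)
app-exposure minM d with app-inversion d
... | _ , _ , df , _ with <:ₐ-compound⇒⇑ (minM df) ⇒-compound
... | N , e , _ = N , e

app-head-<: : Minimal Γ f M → Γ ⊢ M ⇑ N → Γ ⊢ app f s ∶ U →
  Σ Ty λ A → Σ Ty λ B → Γ ⊢ₐ N <: A ⇒ B × Γ ⊢ s ∶ A × Γ ⊢ₐ B <: U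
app-head-<: minM e d with app-inversion d
... | A , B , df , ds , B<:U = A , B , ⇑-<:ₐ e (minM df) ⇒-compound , ds , B<:U

tapp-exposure : Minimal Γ f M → Γ ⊢ tapp f S ∶ U → ∃ (Γ ⊢ M ⇑_)
tapp-exposure minM d with tapp-inversion d
... | _ , _ , df , _ with <:ₐ-compound⇒⇑ (minM df) all-compound
... | N , e , _ = N , e

tapp-head-<: : Minimal Γ f M → Γ ⊢ M ⇑ N → Γ ⊢ tapp f S ∶ U →
  Σ Ty λ A → Σ Ty λ B → Γ ⊢ₐ N <: all A B × Γ ⊢ₐ S <: A × Γ ⊢ₐ B [ S ] <: U
tapp-head-<: minM e d with tapp-inversion d
... | A , B , df , S<:A , B<:U = A , B , ⇑-<:ₐ e (minM df) all-compound , S<:A , B<:U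

check-inferred : Γ ⊢ top → Inference Γ t → ∀ T → Dec (Γ ⊢ t ∶ T)
check-inferred {Γ} wf (minimal M dM minM) T with <:ₐ? Γ M T
... | yes M<:T = yes (subsumeₐ wf dM M<:T)
... | no ¬M<:T = no λ d → ¬M<:T (minM d)
check-inferred wf (untypable ¬d) T = no ¬d

infer-app : Γ ⊢ top → Inference Γ f → (∀ A → Dec (Γ ⊢ s ∶ A)) → Inference Γ (app f s)
infer-app wf (untypable ¬df) _ = untypable λ d → let (_ , _ , df , _) = app-inversion d in ¬df df
infer-app {Γ} wf (minimal M dM minM) check-s with exposure? Γ M
... | no ¬e = untypable λ d → ¬e (app-exposure minM d)
... | yes (N , e) with ⇑-target e
...   | all-compound = untypable λ d → case app-head-<: minM e d of λ { (_ , _ , () , _) }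
...   | ⇒-compound {A} {B} with check-s A
...     | yes ds = minimal B (t-app (subsumeₐ wf dM (⇑⇒<:ₐ e)) ds) λ d →
  case app-head-<: minM e d of λ { (_ , _ , sa-arr _ B<:B₂ , _ , B₂<:U) → <:ₐ-trans B<:B₂ B₂<:U }
...     | no ¬ds = untypable λ d →
  case app-head-<: minM e d of λ { (_ , _ , sa-arr A₂<:A _ , ds , _) → ¬ds (subsumeₐ wf ds A₂<:A) }

infer-tapp : Γ ⊢ top → Inference Γ f → ∀ S → Inference Γ (tapp f S)
infer-tapp wf (untypable ¬df) _ = untypable λ d → let (_ , _ , df , _) = tapp-inversion d in ¬df df
infer-tapp {Γ} wf (minimal M dM minM) S with exposure? Γ M
... | no ¬e = untypable λ d → ¬e (tapp-exposure minM d)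
... | yes (N , e) with ⇑-target e
...   | ⇒-compound = untypable λ d → case tapp-head-<: minM e d of λ { (_ , _ , () , _) }
...   | all-compound {A} {B} with <:ₐ? Γ S A
...     | yes S<:A =
  minimal (B [ S ]) (t-tapp (subsumeₐ wf dM (⇑⇒<:ₐ e)) (<:ₐ⇒<: wf S<:A)) λ d →
  case tapp-head-<: minM e d of λ
    { (_ , _ , sa-all _ B<:B₂ , _ , B₂<:U) → <:ₐ-trans (<:ₐ-subst S drop-here B<:B₂) B₂<:U }
...     | no ¬S<:A = untypable λ d →
  case tapp-head-<: minM e d of λ { (_ , _ , sa-all A₂<:A _ , S<:A₂ , _) → ¬S<:A (<:ₐ-trans S<:A₂ A₂<:A) }

check-lam : Γ ⊢ top → Γ ⊢ S → (∀ B → Dec ((Γ ,∶ S) ⊢ u ∶ B)) → ∀ T → Dec (Γ ⊢ lam S u ∶ T)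
check-lam wf wfS check-u top with check-u top
... | yes du = yes (t-sub (t-lam du) s-top)
... | no ¬du = no λ d → let (_ , du , _) = lam-inversion d in ¬du (t-sub du s-top)
check-lam {Γ} {S} wf wfS check-u (A ⇒ B) with <:ₐ? Γ A S | check-u B
... | yes A<:S | yes du = yes (t-sub (t-lam du) (s-arr (<:ₐ⇒<: wf A<:S) s-refl))
... | no ¬A<:S | _      = no λ d → case lam-inversion d of λ { (_ , _ , sa-arr A<:S _) → ¬A<:S A<:S }
... | yes _    | no ¬du = no λ d → case lam-inversion d of λ
  { (_ , du , sa-arr _ T<:B) → ¬du (subsumeₐ (wf-wkX wfS wf) du (<:ₐ-weaken insert-here T<:B)) }
check-lam wf wfS check-u (var _)   = no λ d → case lam-inversion d of λ { (_ , _ , ()) }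
check-lam wf wfS check-u (all _ _) = no λ d → case lam-inversion d of λ { (_ , _ , ()) }

check-tlam : Γ ⊢ top → Γ ⊢ S → (∀ B → Dec ((Γ ,<: S) ⊢ u ∶ B)) → ∀ T → Dec (Γ ⊢ tlam S u ∶ T)
check-tlam wf wfS check-u top with check-u top
... | yes du = yes (t-sub (t-tlam du) s-top)
... | no ¬du = no λ d → let (_ , du , _) = tlam-inversion d in ¬du (t-sub du s-top)
check-tlam {Γ} {S} wf wfS check-u (all A B) with <:ₐ? Γ A S | check-u B
... | yes A<:S | yes du = yes (t-sub (t-tlam du) (s-all (<:ₐ⇒<: wf A<:S) s-refl))
... | no ¬A<:S | _      = no λ d → case tlam-inversion d of λ { (_ , _ , sa-all A<:S _) → ¬A<:S A<:S }
... | yes _    | no ¬du = no λ d → case tlam-inversion d of λ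
  { (_ , du , sa-all _ T<:B) → ¬du (subsumeₐ (wf-wkT wfS wf) du (<:ₐ-narrow narrow-here T<:B)) }
check-tlam wf wfS check-u (var _)   = no λ d → case tlam-inversion d of λ { (_ , _ , ()) }
check-tlam wf wfS check-u (_ ⇒ _)   = no λ d → case tlam-inversion d of λ { (_ , _ , ()) }

data Neutral : Tm → Set where
  top  : Neutral top
  var  : Neutral (var n)
  app  : Neutral (app f s)
  tapp : Neutral (tapp f S)

notLam⇒neutral⊎tlam : NotLam t → Neutral t ⊎ Σ Ty λ S → Σ Tm λ u → t ≡ tlam S u
notLam⇒neutral⊎tlam nl-top  = inj₁ top
notLam⇒neutral⊎tlam nl-var  = inj₁ var
notLam⇒neutral⊎tlam nl-tlam = inj₂ (_ , _ , refl)
notLam⇒neutral⊎tlam nl-app  = inj₁ app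
notLam⇒neutral⊎tlam nl-tapp = inj₁ tapp

notTLam⇒neutral⊎lam : NotTLam t → Neutral t ⊎ Σ Ty λ S → Σ Tm λ u → t ≡ lam S u
notTLam⇒neutral⊎lam nt-top  = inj₁ top
notTLam⇒neutral⊎lam nt-var  = inj₁ var
notTLam⇒neutral⊎lam nt-lam  = inj₂ (_ , _ , refl)
notTLam⇒neutral⊎lam nt-app  = inj₁ app
notTLam⇒neutral⊎lam nt-tapp = inj₁ tapp

mutual
  check : ∀ Γ t T → Γ ⊢ top → AnnWf Γ t → BetaNormal t → Dec (Γ ⊢ t ∶ T)
  check Γ (lam S u)  T wf (a-lam wfS au) (bn-lam bu) =
    check-lam wf wfS (λ B → check (Γ ,∶ S) u B (wf-wkX wfS wf) au bu) T
  check Γ (tlam S u) T wf (a-tlam wfS au) (bn-tlam bu) =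
    check-tlam wf wfS (λ B → check (Γ ,<: S) u B (wf-wkT wfS wf) au bu) T
  check Γ top        T wf a b = check-inferred wf (infer Γ top wf a b top) T
  check Γ (var n)    T wf a b = check-inferred wf (infer Γ (var n) wf a b var) T
  check Γ (app f s)  T wf a b = check-inferred wf (infer Γ (app f s) wf a b app) T
  check Γ (tapp f S) T wf a b = check-inferred wf (infer Γ (tapp f S) wf a b tapp) T

  infer : ∀ Γ t → Γ ⊢ top → AnnWf Γ t → BetaNormal t → Neutral t → Inference Γ t
  infer Γ top wf _ _ _ = minimal top (t-top wf) top-inversion
  infer Γ (var n) wf _ _ _ with tmVar? Γ n
  ... | yes (T , p) = minimal T (t-var wf p) (var-minimal p)
  ... | no ¬p       = untypable λ d → let (T , p , _) = var-inversion d in ¬p (T , p)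
  infer Γ (app f s) wf (a-app af as) (bn-app nl bf bs) _ with notLam⇒neutral⊎tlam nl
  ... | inj₁ nf = infer-app wf (infer Γ f wf af bf nf) (λ A → check Γ s A wf as bs)
  ... | inj₂ (_ , _ , refl) = untypable λ d →
    let (_ , _ , df , _) = app-inversion d in case tlam-inversion df of λ { (_ , _ , ()) }
  infer Γ (tapp f S) wf (a-tapp af _) (bn-tapp nt bf) _ with notTLam⇒neutral⊎lam nt
  ... | inj₁ nf = infer-tapp wf (infer Γ f wf af bf nf) S
  ... | inj₂ (_ , _ , refl) = untypable λ d →
    let (_ , _ , df , _) = tapp-inversion d in case lam-inversion df of λ { (_ , _ , ()) }

mainTheorem1 : (Θ : Ctx) (t : Tm) (T : Ty) →
    WfTerm Θ t → BetaNormal t → Θ ⊢ T → Dec (Θ ⊢ t ∶ T)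
mainTheorem1 Θ t T (wfTerm ctxWf annWf) bn _ = check Θ t T ctxWf annWf bn
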